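{- Let $G$ be a finite simple graph on $n$ vertices. Then $noc(G)\le 2^n$. Moreover, equality holds if and only if $G$ is isomorphic to $s\cdot K_1+t\cdot K_2$ for some nonnegative integers $s,t$ with $2t+s=n$.
   Context: For a finite simple undirected graph $G=(V,E)$, a set $S\subseteq V$ is called $P_3$-convex if for every path $x$--$z$--$y$ in $G$ (distinct vertices $x,z,y$ with $xz,zy\in E$) with $x,y\in S$, we also have $z\in S$. The number $noc(G)$ denotes the number of $P_3$-convex subsets of $V$ (including $\emptyset$). $K_m$ is the complete graph on $m$ vertices, $H_1+H_2$ denotes the disjoint union of graphs, and $s\cdot H$ denotes the disjoint union of $s$ copies of $H$. -}

module Defs where

open import Data.Nat using (ℕ; zero; suc; _+_; _*_)
open import Data.Bool using (Bool; true; false; T)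
open import Data.Fin using (Fin; splitAt)
open import Data.Fin.Subset using (Subset; _∈_)
open import Data.Fin.Subset.Properties using (_∈?_)
open import Data.Vec using ([]; _∷_)
open import Data.List using (List; []; _∷_; _++_; map; length; filter)
open import Data.Sum using (inj₁; inj₂)
open import Data.Product using (_×_; Σ)
open import Relation.Binary.PropositionalEquality using (_≡_; _≢_)
open import Relation.Nullary using (¬_; Dec; yes; no)
open import Data.Empty using (⊥-elim)
open import Relation.Binary.PropositionalEquality using (refl) renaming (sym to ≡-sym)
open import Relation.Nullary.Decidable using (_×-dec_; ¬?; _→-dec_)
open import Data.Fin using (_≟_)
open import Data.Fin.Properties using (all?)
open import Data.Bool.Properties using (T?)
open import Function.Bundles using (_↔_; Inverse)

record Graph (n : ℕ) : Set where
  field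
    adj   : Fin n → Fin n → Bool
    sym   : ∀ u v → adj u v ≡ adj v u
    irrefl : ∀ v → adj v v ≡ false
open Graph public

Adj : ∀ {n} → Graph n → Fin n → Fin n → Set
Adj G u v = T (adj G u v)

IsP3Convex : ∀ {n} → Graph n → Subset n → Set
IsP3Convex G S = ∀ x z y → x ≢ z → z ≢ y → x ≢ y →
  Adj G x z → Adj G z y → x ∈ S → y ∈ S → z ∈ S

isP3Convex? : ∀ {n} (G : Graph n) (S : Subset n) → Dec (IsP3Convex G S)
isP3Convex? G S = all? λ x → all? λ z → all? λ y →
  ¬? (x ≟ z) →-dec (¬? (z ≟ y) →-dec (¬? (x ≟ y) →-dec
  (T? (adj G x z) →-dec (T? (adj G z y) →-dec
  ((x ∈? S) →-dec ((y ∈? S) →-dec (z ∈? S)))))))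

allSubsets : (n : ℕ) → List (Subset n)
allSubsets zero = [] ∷ []
allSubsets (suc n) = map (true ∷_) (allSubsets n) ++ map (false ∷_) (allSubsets n)

noc : ∀ {n} → Graph n → ℕ
noc G = length (filter (isP3Convex? G) (allSubsets _))

adjK : ∀ {m} → Fin m → Fin m → Bool
adjK u v with u ≟ v
... | yes _ = false
... | no _ = true

K : (m : ℕ) → Graph m
K m = record { adj = adjK ; sym = symK ; irrefl = irrK }
  where
  symK : (u v : Fin m) → adjK u v ≡ adjK v u
  symK u v with u ≟ v | v ≟ u
  ... | yes _ | yes _ = refl
  ... | no _  | no _  = refl
  ... | yes p | no q  = ⊥-elim (q (≡-sym p))
  ... | no p  | yes q = ⊥-elim (p (≡-sym q))
  irrK : (v : Fin m) → adjK v v ≡ false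
  irrK v with v ≟ v
  ... | yes _ = refl
  ... | no p  = ⊥-elim (p refl)

adj⊎ : ∀ {m k} → Graph m → Graph k → Fin (m + k) → Fin (m + k) → Bool
adj⊎ {m} H₁ H₂ u v with splitAt m u | splitAt m v
... | inj₁ a | inj₁ b = adj H₁ a b
... | inj₂ a | inj₂ b = adj H₂ a b
... | inj₁ _ | inj₂ _ = false
... | inj₂ _ | inj₁ _ = false

_⊕_ : ∀ {m k} → Graph m → Graph k → Graph (m + k)
_⊕_ {m} {k} H₁ H₂ = record { adj = adj⊎ H₁ H₂ ; sym = sym⊎ ; irrefl = irr⊎ }
  where
  sym⊎ : (u v : Fin (m + k)) → adj⊎ H₁ H₂ u v ≡ adj⊎ H₁ H₂ v u
  sym⊎ u v with splitAt m u | splitAt m v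
  ... | inj₁ a | inj₁ b = sym H₁ a b
  ... | inj₂ a | inj₂ b = sym H₂ a b
  ... | inj₁ _ | inj₂ _ = refl
  ... | inj₂ _ | inj₁ _ = refl
  irr⊎ : (v : Fin (m + k)) → adj⊎ H₁ H₂ v v ≡ false
  irr⊎ v with splitAt m v
  ... | inj₁ a = irrefl H₁ a
  ... | inj₂ a = irrefl H₂ a

K₀ : Graph 0
K₀ = K 0

copies : ∀ {m} (s : ℕ) → Graph m → Graph (s * m)
copies zero    H = K₀
copies (suc s) H = H ⊕ copies s H

_≅_ : ∀ {m k} → Graph m → Graph k → Set
_≅_ {m} {k} G H = Σ (Fin m ↔ Fin k) λ f →
  ∀ u v → adj G u v ≡ adj H (Inverse.to f u) (Inverse.to f v)

{-# OPTIONS --safe #-}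
module Submission where

-- If x – z – y is a path with x ≠ y, the complement of {z} contains x and y but not z, so it
-- is not P3-convex.  Paths with x = y never violate convexity.  Hence all 2^n subsets are
-- convex exactly when G has maximum degree at most 1.  Such a graph splits off its components
-- one at a time: vertex 0 is either isolated (a K₁) or, after a transposition, adjacent to
-- vertex 1, and then {0, 1} is a K₂ component.

open import Defs
open import Data.Nat using (ℕ; zero; suc; _+_; _*_; _≤_; _^_)
open import Data.Nat.Properties using (+-suc; +-identityʳ; *-suc)
open import Data.Bool using (Bool; true; false; T)
open import Data.Bool.Properties using (T?; T-≡)
open import Data.Fin using (Fin; zero; suc; splitAt; _↑ʳ_; _≟_)
open import Data.Fin.Properties using (+↔⊎; any?; suc-injective; ↑ʳ-injective)
open import Data.Fin.Subset using (Subset; _∈_; ⁅_⁆; ∁)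
open import Data.Fin.Subset.Properties using (x∈⁅x⁆; x≢y⇒x∉⁅y⁆; x∉p⇒x∈∁p; x∈∁p⇒x∉p)
open import Data.Fin.Permutation using (Permutation; transpose; _⟨$⟩ʳ_)
open import Data.Sum using (_⊎_; inj₁; inj₂)
open import Data.Sum.Algebra using (⊎-cong; ⊎-comm; ⊎-assoc)
open import Data.Product using (_×_; Σ; _,_)
open import Data.List using (List; _++_; map; length; filter)
open import Data.List.Properties using (length-++; length-map; length-filter; filter-all; filter-complete)
open import Data.List.Membership.Propositional as List using ()
open import Data.List.Membership.Propositional.Properties using (∈-map⁺; ∈-++⁺ˡ; ∈-++⁺ʳ)
open import Data.List.Relation.Unary.Any using (here)
open import Data.List.Relation.Unary.All as All using (All)
open import Data.List.Relation.Unary.All.Properties using (all-filter)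
import Data.Vec as Vec
open import Data.Empty using (⊥-elim)
open import Relation.Nullary using (¬_; yes; no; contradiction)
open import Relation.Unary using (Decidable)
open import Relation.Binary.PropositionalEquality
  using (_≡_; _≢_; refl; trans; cong; cong₂; subst; module ≡-Reasoning)
  renaming (sym to ≡-sym)
open import Function using (_∘_)
open import Function.Definitions using (Injective)
open import Function.Bundles using (_↔_; _⇔_; Inverse; mk⇔; Equivalence)
open import Function.Properties.Inverse using (↔-refl; ↔-sym; ↔-trans)
import Function.Properties.Equivalence as ⇔

open Inverse using (to; from; strictlyInverseˡ)

private
  variable
    m m′ n k k′ l : ℕ
    A B : Set

¬T⇒≡false : ∀ {b} → ¬ T b → b ≡ false
¬T⇒≡false {false} _ = refl
¬T⇒≡false {true} ¬t = ⊥-elim (¬t _)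

length-filter≡length⇔all : {P : A → Set} (P? : Decidable P) {xs : List A} →
  (∀ x → x List.∈ xs) → length (filter P? xs) ≡ length xs ⇔ (∀ x → P x)
length-filter≡length⇔all P? {xs} complete = mk⇔
  (λ eq x → All.lookup (subst (All _) (filter-complete P? eq) (all-filter P? xs)) (complete x))
  (λ ∀P → cong length (filter-all P? (All.universal ∀P xs)))

length-allSubsets : ∀ n → length (allSubsets n) ≡ 2 ^ n
length-allSubsets zero = refl
length-allSubsets (suc n) = begin
  length (map (true Vec.∷_) subsets ++ map (false Vec.∷_) subsets)
    ≡⟨ length-++ (map (true Vec.∷_) subsets) ⟩
  length (map (true Vec.∷_) subsets) + length (map (false Vec.∷_) subsets)
    ≡⟨ cong₂ _+_ (length-map _ subsets) (length-map _ subsets) ⟩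
  length subsets + length subsets
    ≡⟨ cong (λ c → c + c) (length-allSubsets n) ⟩
  2 ^ n + 2 ^ n
    ≡⟨ cong (2 ^ n +_) (≡-sym (+-identityʳ (2 ^ n))) ⟩
  2 ^ suc n ∎
  where
  open ≡-Reasoning
  subsets : List (Subset n)
  subsets = allSubsets n

∈-allSubsets : (S : Subset n) → S List.∈ allSubsets n
∈-allSubsets Vec.[] = here refl
∈-allSubsets (true Vec.∷ S) = ∈-++⁺ˡ (∈-map⁺ (true Vec.∷_) (∈-allSubsets S))
∈-allSubsets {suc n} (false Vec.∷ S) =
  ∈-++⁺ʳ (map (true Vec.∷_) (allSubsets n)) (∈-map⁺ (false Vec.∷_) (∈-allSubsets S))

noc≤2^n : (G : Graph n) → noc G ≤ 2 ^ n
noc≤2^n {n} G = subst (noc G ≤_) (length-allSubsets n) (length-filter (isP3Convex? G) (allSubsets n))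

noc≡2^n⇔allConvex : (G : Graph n) → noc G ≡ 2 ^ n ⇔ (∀ S → IsP3Convex G S)
noc≡2^n⇔allConvex {n} G = subst (λ c → noc G ≡ c ⇔ (∀ S → IsP3Convex G S)) (length-allSubsets n)
  (length-filter≡length⇔all (isP3Convex? G) ∈-allSubsets)

MaxDegree≤1 : (A → A → Bool) → Set
MaxDegree≤1 R = ∀ x z y → T (R x z) → T (R z y) → x ≡ y

adjacent⇒distinct : (G : Graph n) {u v : Fin n} → Adj G u v → u ≢ v
adjacent⇒distinct G {u} uv refl = subst T (irrefl G u) uv

allConvex⇔maxDegree≤1 : (G : Graph n) → (∀ S → IsP3Convex G S) ⇔ MaxDegree≤1 (adj G)
allConvex⇔maxDegree≤1 G = mk⇔ allConvex⇒maxDegree≤1 maxDegree≤1⇒allConvex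
  where
  maxDegree≤1⇒allConvex : MaxDegree≤1 (adj G) → ∀ S → IsP3Convex G S
  maxDegree≤1⇒allConvex Δ S x z y _ _ x≢y xz zy _ _ = ⊥-elim (x≢y (Δ x z y xz zy))

  allConvex⇒maxDegree≤1 : (∀ S → IsP3Convex G S) → MaxDegree≤1 (adj G)
  allConvex⇒maxDegree≤1 convex x z y xz zy with x ≟ y
  ... | yes x≡y = x≡y
  ... | no x≢y = contradiction (x∈⁅x⁆ z) (x∈∁p⇒x∉p z∈∁⁅z⁆)
    where
    x≢z : x ≢ z
    x≢z = adjacent⇒distinct G xz
    z≢y : z ≢ y
    z≢y = adjacent⇒distinct G zy
    z∈∁⁅z⁆ : z ∈ ∁ ⁅ z ⁆
    z∈∁⁅z⁆ = convex (∁ ⁅ z ⁆) x z y x≢z z≢y x≢y xz zy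
      (x∉p⇒x∈∁p (x≢y⇒x∉⁅y⁆ x≢z)) (x∉p⇒x∈∁p (x≢y⇒x∉⁅y⁆ (z≢y ∘ ≡-sym)))

-- Isomorphism of Bool-valued relations on arbitrary carriers, so that Fin m ⊎ Fin k can serve as
-- an intermediate for G ⊕ H.  For graphs it is Defs._≅_ on adj; it is a record so that
-- reasoning chains can infer their intermediate relations.
record _≅ᵣ_ (R : A → A → Bool) (S : B → B → Bool) : Set where
  constructor mk≅ᵣ
  field
    bijection : A ↔ B
    preserves : ∀ u v → R u v ≡ S (to bijection u) (to bijection v)

module _ {R : A → A → Bool} {S : B → B → Bool} where

  ≅ᵣ-sym : R ≅ᵣ S → S ≅ᵣ R
  ≅ᵣ-sym (mk≅ᵣ f preserves) = mk≅ᵣ (↔-sym f) λ u v → ≡-sym (begin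
    R (from f u) (from f v)               ≡⟨ preserves (from f u) (from f v) ⟩
    S (to f (from f u)) (to f (from f v)) ≡⟨ cong₂ S (strictlyInverseˡ f u) (strictlyInverseˡ f v) ⟩
    S u v                                 ∎)
    where open ≡-Reasoning

  ≅ᵣ-trans : {C : Set} {T : C → C → Bool} → R ≅ᵣ S → S ≅ᵣ T → R ≅ᵣ T
  ≅ᵣ-trans (mk≅ᵣ f p) (mk≅ᵣ g q) = mk≅ᵣ (↔-trans f g) λ u v → trans (p u v) (q (to f u) (to f v))

  maxDegree≤1-resp-≅ᵣ : R ≅ᵣ S → MaxDegree≤1 S → MaxDegree≤1 R
  maxDegree≤1-resp-≅ᵣ (mk≅ᵣ f preserves) Δ x z y xz zy = begin
    x                ≡⟨ ≡-sym (Inverse.strictlyInverseʳ f x) ⟩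
    from f (to f x)  ≡⟨ cong (from f) (Δ _ _ _ (subst T (preserves x z) xz) (subst T (preserves z y) zy)) ⟩
    from f (to f y)  ≡⟨ Inverse.strictlyInverseʳ f y ⟩
    y                ∎
    where open ≡-Reasoning

≅ᵣ-refl : {R : A → A → Bool} → R ≅ᵣ R
≅ᵣ-refl = mk≅ᵣ ↔-refl λ u v → refl

infixr 5 _⊎ᵣ_

_⊎ᵣ_ : (A → A → Bool) → (B → B → Bool) → A ⊎ B → A ⊎ B → Bool
(R ⊎ᵣ S) (inj₁ a) (inj₁ b) = R a b
(R ⊎ᵣ S) (inj₂ a) (inj₂ b) = S a b
(R ⊎ᵣ S) (inj₁ _) (inj₂ _) = false
(R ⊎ᵣ S) (inj₂ _) (inj₁ _) = false

module _ {R : A → A → Bool} {S : B → B → Bool} where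

  ⊎ᵣ-cong : {A′ B′ : Set} {R′ : A′ → A′ → Bool} {S′ : B′ → B′ → Bool} →
    R ≅ᵣ R′ → S ≅ᵣ S′ → (R ⊎ᵣ S) ≅ᵣ (R′ ⊎ᵣ S′)
  ⊎ᵣ-cong {R′ = R′} {S′} (mk≅ᵣ f p) (mk≅ᵣ g q) = mk≅ᵣ (⊎-cong f g) preserves
    where
    preserves : ∀ u v → (R ⊎ᵣ S) u v ≡ (R′ ⊎ᵣ S′) (to (⊎-cong f g) u) (to (⊎-cong f g) v)
    preserves (inj₁ a) (inj₁ b) = p a b
    preserves (inj₂ a) (inj₂ b) = q a b
    preserves (inj₁ a) (inj₂ b) = refl
    preserves (inj₂ a) (inj₁ b) = refl

  ⊎ᵣ-comm : (R ⊎ᵣ S) ≅ᵣ (S ⊎ᵣ R)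
  ⊎ᵣ-comm = mk≅ᵣ (⊎-comm A B) preserves
    where
    preserves : ∀ u v → (R ⊎ᵣ S) u v ≡ (S ⊎ᵣ R) (to (⊎-comm A B) u) (to (⊎-comm A B) v)
    preserves (inj₁ a) (inj₁ b) = refl
    preserves (inj₂ a) (inj₂ b) = refl
    preserves (inj₁ a) (inj₂ b) = refl
    preserves (inj₂ a) (inj₁ b) = refl

  ⊎ᵣ-assoc : {C : Set} {T : C → C → Bool} → ((R ⊎ᵣ S) ⊎ᵣ T) ≅ᵣ (R ⊎ᵣ (S ⊎ᵣ T))
  ⊎ᵣ-assoc {C} {T} = mk≅ᵣ (⊎-assoc _ A B C) preserves
    where
    preserves : ∀ u v → ((R ⊎ᵣ S) ⊎ᵣ T) u v ≡ (R ⊎ᵣ (S ⊎ᵣ T)) (to (⊎-assoc _ A B C) u) (to (⊎-assoc _ A B C) v)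
    preserves (inj₁ (inj₁ a)) (inj₁ (inj₁ b)) = refl
    preserves (inj₁ (inj₁ a)) (inj₁ (inj₂ b)) = refl
    preserves (inj₁ (inj₁ a)) (inj₂ c)        = refl
    preserves (inj₁ (inj₂ a)) (inj₁ (inj₁ b)) = refl
    preserves (inj₁ (inj₂ a)) (inj₁ (inj₂ b)) = refl
    preserves (inj₁ (inj₂ a)) (inj₂ c)        = refl
    preserves (inj₂ a)        (inj₁ (inj₁ b)) = refl
    preserves (inj₂ a)        (inj₁ (inj₂ b)) = refl
    preserves (inj₂ a)        (inj₂ c)        = refl

  maxDegree≤1-⊎ᵣ : MaxDegree≤1 R → MaxDegree≤1 S → MaxDegree≤1 (R ⊎ᵣ S)
  maxDegree≤1-⊎ᵣ ΔR ΔS (inj₁ x) (inj₁ z) (inj₁ y) xz zy = cong inj₁ (ΔR x z y xz zy)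
  maxDegree≤1-⊎ᵣ ΔR ΔS (inj₂ x) (inj₂ z) (inj₂ y) xz zy = cong inj₂ (ΔS x z y xz zy)
  maxDegree≤1-⊎ᵣ ΔR ΔS (inj₁ x) (inj₂ z) _        () _
  maxDegree≤1-⊎ᵣ ΔR ΔS (inj₂ x) (inj₁ z) _        () _
  maxDegree≤1-⊎ᵣ ΔR ΔS (inj₁ x) (inj₁ z) (inj₂ y) _  ()
  maxDegree≤1-⊎ᵣ ΔR ΔS (inj₂ x) (inj₂ z) (inj₁ y) _  ()

module ≅ᵣ-Reasoning where

  infixr 2 _≅⟨_⟩_
  infix  3 _∎

  _≅⟨_⟩_ : {C : Set} (R : A → A → Bool) {S : B → B → Bool} {T : C → C → Bool} →
    R ≅ᵣ S → S ≅ᵣ T → R ≅ᵣ T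
  R ≅⟨ R≅S ⟩ S≅T = ≅ᵣ-trans R≅S S≅T

  _∎ : (R : A → A → Bool) → R ≅ᵣ R
  R ∎ = ≅ᵣ-refl

⊕≅⊎ᵣ : (G : Graph m) (H : Graph k) → adj (G ⊕ H) ≅ᵣ (adj G ⊎ᵣ adj H)
⊕≅⊎ᵣ {m} G H = mk≅ᵣ +↔⊎ preserves
  where
  preserves : ∀ u v → adj (G ⊕ H) u v ≡ (adj G ⊎ᵣ adj H) (splitAt m u) (splitAt m v)
  preserves u v with splitAt m u | splitAt m v
  ... | inj₁ a | inj₁ b = refl
  ... | inj₂ a | inj₂ b = refl
  ... | inj₁ a | inj₂ b = refl
  ... | inj₂ a | inj₁ b = refl

⊕-cong : {G : Graph m} {G′ : Graph m′} {H : Graph k} {H′ : Graph k′} →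
  adj G ≅ᵣ adj G′ → adj H ≅ᵣ adj H′ → adj (G ⊕ H) ≅ᵣ adj (G′ ⊕ H′)
⊕-cong {G = G} {G′} {H} {H′} G≅G′ H≅H′ =
  adj (G ⊕ H)         ≅⟨ ⊕≅⊎ᵣ G H ⟩
  adj G ⊎ᵣ adj H      ≅⟨ ⊎ᵣ-cong G≅G′ H≅H′ ⟩
  adj G′ ⊎ᵣ adj H′    ≅⟨ ≅ᵣ-sym (⊕≅⊎ᵣ G′ H′) ⟩
  adj (G′ ⊕ H′)       ∎
  where open ≅ᵣ-Reasoning

⊕-comm : (G : Graph m) (H : Graph k) → adj (G ⊕ H) ≅ᵣ adj (H ⊕ G)
⊕-comm G H =
  adj (G ⊕ H)      ≅⟨ ⊕≅⊎ᵣ G H ⟩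
  adj G ⊎ᵣ adj H   ≅⟨ ⊎ᵣ-comm ⟩
  adj H ⊎ᵣ adj G   ≅⟨ ≅ᵣ-sym (⊕≅⊎ᵣ H G) ⟩
  adj (H ⊕ G)      ∎
  where open ≅ᵣ-Reasoning

⊕-assoc : (G : Graph m) (H : Graph k) (J : Graph l) → adj ((G ⊕ H) ⊕ J) ≅ᵣ adj (G ⊕ (H ⊕ J))
⊕-assoc G H J =
  adj ((G ⊕ H) ⊕ J)            ≅⟨ ⊕≅⊎ᵣ (G ⊕ H) J ⟩
  adj (G ⊕ H) ⊎ᵣ adj J         ≅⟨ ⊎ᵣ-cong (⊕≅⊎ᵣ G H) ≅ᵣ-refl ⟩
  (adj G ⊎ᵣ adj H) ⊎ᵣ adj J    ≅⟨ ⊎ᵣ-assoc ⟩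
  adj G ⊎ᵣ (adj H ⊎ᵣ adj J)    ≅⟨ ⊎ᵣ-cong ≅ᵣ-refl (≅ᵣ-sym (⊕≅⊎ᵣ H J)) ⟩
  adj G ⊎ᵣ adj (H ⊕ J)         ≅⟨ ≅ᵣ-sym (⊕≅⊎ᵣ G (H ⊕ J)) ⟩
  adj (G ⊕ (H ⊕ J))            ∎
  where open ≅ᵣ-Reasoning

maxDegree≤1-⊕ : {G : Graph m} {H : Graph k} →
  MaxDegree≤1 (adj G) → MaxDegree≤1 (adj H) → MaxDegree≤1 (adj (G ⊕ H))
maxDegree≤1-⊕ {G = G} {H} ΔG ΔH = maxDegree≤1-resp-≅ᵣ (⊕≅⊎ᵣ G H) (maxDegree≤1-⊎ᵣ ΔG ΔH)

maxDegree≤1-K₁ : MaxDegree≤1 (adj (K 1))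
maxDegree≤1-K₁ zero zero _ () _

maxDegree≤1-K₂ : MaxDegree≤1 (adj (K 2))
maxDegree≤1-K₂ zero       zero       _          () _
maxDegree≤1-K₂ (suc zero) (suc zero) _          () _
maxDegree≤1-K₂ zero       (suc zero) zero       _  _ = refl
maxDegree≤1-K₂ (suc zero) zero       (suc zero) _  _ = refl
maxDegree≤1-K₂ zero       (suc zero) (suc zero) _  ()
maxDegree≤1-K₂ (suc zero) zero       zero       _  ()

maxDegree≤1-copies : ∀ s {H : Graph m} → MaxDegree≤1 (adj H) → MaxDegree≤1 (adj (copies s H))
maxDegree≤1-copies zero    ΔH ()
maxDegree≤1-copies (suc s) ΔH = maxDegree≤1-⊕ ΔH (maxDegree≤1-copies s ΔH)

record K₁K₂Decomposition (G : Graph n) : Set where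
  constructor decomposition
  field
    s t  : ℕ
    size : 2 * t + s ≡ n
    iso  : adj G ≅ᵣ adj (copies s (K 1) ⊕ copies t (K 2))

decomposition⇒maxDegree≤1 : (G : Graph n) → K₁K₂Decomposition G → MaxDegree≤1 (adj G)
decomposition⇒maxDegree≤1 G (decomposition s t _ G≅) = maxDegree≤1-resp-≅ᵣ G≅
  (maxDegree≤1-⊕ (maxDegree≤1-copies s maxDegree≤1-K₁) (maxDegree≤1-copies t maxDegree≤1-K₂))

decomposition-resp-≅ᵣ : {G H : Graph n} → adj G ≅ᵣ adj H → K₁K₂Decomposition H → K₁K₂Decomposition G
decomposition-resp-≅ᵣ G≅H (decomposition s t size H≅) = decomposition s t size (≅ᵣ-trans G≅H H≅)

K₁⊕-decomposition : {G : Graph n} → K₁K₂Decomposition G → K₁K₂Decomposition (K 1 ⊕ G)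
K₁⊕-decomposition {G = G} (decomposition s t size G≅) =
  decomposition (suc s) t (trans (+-suc (2 * t) s) (cong suc size)) (
    adj (K 1 ⊕ G)                                  ≅⟨ ⊕-cong ≅ᵣ-refl G≅ ⟩
    adj (K 1 ⊕ (copies s (K 1) ⊕ copies t (K 2)))  ≅⟨ ≅ᵣ-sym (⊕-assoc (K 1) _ _) ⟩
    adj ((K 1 ⊕ copies s (K 1)) ⊕ copies t (K 2))  ∎)
  where open ≅ᵣ-Reasoning

K₂⊕-decomposition : {G : Graph n} → K₁K₂Decomposition G → K₁K₂Decomposition (K 2 ⊕ G)
K₂⊕-decomposition {G = G} (decomposition s t size G≅) =
  decomposition s (suc t) (trans (cong (_+ s) (*-suc 2 t)) (cong (2 +_) size)) (
    adj (K 2 ⊕ G)            ≅⟨ ⊕-cong ≅ᵣ-refl G≅ ⟩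
    adj (K 2 ⊕ (sK₁ ⊕ tK₂))  ≅⟨ ≅ᵣ-sym (⊕-assoc (K 2) sK₁ tK₂) ⟩
    adj ((K 2 ⊕ sK₁) ⊕ tK₂)  ≅⟨ ⊕-cong (⊕-comm (K 2) sK₁) ≅ᵣ-refl ⟩
    adj ((sK₁ ⊕ K 2) ⊕ tK₂)  ≅⟨ ⊕-assoc sK₁ (K 2) tK₂ ⟩
    adj (sK₁ ⊕ (K 2 ⊕ tK₂))  ∎)
  where
  open ≅ᵣ-Reasoning
  sK₁ : Graph (s * 1)
  sK₁ = copies s (K 1)
  tK₂ : Graph (t * 2)
  tK₂ = copies t (K 2)

induced : Graph n → (Fin m → Fin n) → Graph m
induced G f = record
  { adj    = λ u v → adj G (f u) (f v)
  ; sym    = λ u v → Graph.sym G (f u) (f v)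
  ; irrefl = irrefl G ∘ f
  }

induced-≅ᵣ : (G : Graph n) (f : Fin m ↔ Fin n) → adj (induced G (to f)) ≅ᵣ adj G
induced-≅ᵣ G f = mk≅ᵣ f λ u v → refl

maxDegree≤1-induced : (G : Graph n) (f : Fin m → Fin n) → Injective _≡_ _≡_ f →
  MaxDegree≤1 (adj G) → MaxDegree≤1 (adj (induced G f))
maxDegree≤1-induced G f f-injective Δ x z y xz zy = f-injective (Δ _ _ _ xz zy)

Adj-sym : (G : Graph n) {u v : Fin n} → Adj G u v → Adj G v u
Adj-sym G {u} {v} = subst T (Graph.sym G u v)

otherNeighbour≡false : (G : Graph n) → MaxDegree≤1 (adj G) →
  {w u v : Fin n} → Adj G w u → v ≢ w → adj G u v ≡ false
otherNeighbour≡false G Δ wu v≢w = ¬T⇒≡false λ uv → v≢w (≡-sym (Δ _ _ _ wu uv))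

isolated⇒≅K₁⊕ : (G : Graph (suc n)) → (∀ v → ¬ Adj G zero v) → adj G ≅ᵣ adj (K 1 ⊕ induced G suc)
isolated⇒≅K₁⊕ G isolated = mk≅ᵣ ↔-refl preserves
  where
  preserves : ∀ u v → adj G u v ≡ adj (K 1 ⊕ induced G suc) u v
  preserves zero    zero    = ¬T⇒≡false (isolated zero)
  preserves zero    (suc v) = ¬T⇒≡false (isolated (suc v))
  preserves (suc u) zero    = ¬T⇒≡false (isolated (suc u) ∘ Adj-sym G)
  preserves (suc u) (suc v) = refl

matched⇒≅K₂⊕ : (G : Graph (suc (suc n))) → MaxDegree≤1 (adj G) → Adj G zero (suc zero) →
  adj G ≅ᵣ adj (K 2 ⊕ induced G (2 ↑ʳ_))
matched⇒≅K₂⊕ G Δ 0~1 = mk≅ᵣ ↔-refl preserves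
  where
  preserves : ∀ u v → adj G u v ≡ adj (K 2 ⊕ induced G (2 ↑ʳ_)) u v
  preserves zero             zero             = irrefl G zero
  preserves zero             (suc zero)       = Equivalence.to T-≡ 0~1
  preserves zero             (suc (suc v))    = otherNeighbour≡false G Δ (Adj-sym G 0~1) λ ()
  preserves (suc zero)       zero             = Equivalence.to T-≡ (Adj-sym G 0~1)
  preserves (suc zero)       (suc zero)       = irrefl G (suc zero)
  preserves (suc zero)       (suc (suc v))    = otherNeighbour≡false G Δ 0~1 λ ()
  preserves (suc (suc u))    zero             = trans (Graph.sym G _ _) (preserves zero (suc (suc u)))
  preserves (suc (suc u))    (suc zero)       = trans (Graph.sym G _ _) (preserves (suc zero) (suc (suc u)))
  preserves (suc (suc u))    (suc (suc v))    = refl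

maxDegree≤1⇒decomposition : (G : Graph n) → MaxDegree≤1 (adj G) → K₁K₂Decomposition G
matched⇒decomposition : (G : Graph (suc n)) → MaxDegree≤1 (adj G) →
  (p : Fin n) → Adj G zero (suc p) → K₁K₂Decomposition G

maxDegree≤1⇒decomposition {zero} G Δ = decomposition 0 0 refl (mk≅ᵣ ↔-refl λ ())
maxDegree≤1⇒decomposition {suc n} G Δ with any? (λ v → T? (adj G zero v))
... | no isolated = decomposition-resp-≅ᵣ (isolated⇒≅K₁⊕ G (λ v 0~v → isolated (v , 0~v)))
  (K₁⊕-decomposition (maxDegree≤1⇒decomposition (induced G suc) (maxDegree≤1-induced G suc suc-injective Δ)))
... | yes (zero , 0~0)  = ⊥-elim (adjacent⇒distinct G 0~0 refl)
... | yes (suc p , 0~p) = matched⇒decomposition G Δ p 0~p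

matched⇒decomposition {suc n} G Δ p 0~p =
  decomposition-resp-≅ᵣ {H = H} (≅ᵣ-sym (induced-≅ᵣ G σ)) (decomposition-resp-≅ᵣ (matched⇒≅K₂⊕ H ΔH 0~p)
    (K₂⊕-decomposition (maxDegree≤1⇒decomposition (induced H (2 ↑ʳ_))
      (maxDegree≤1-induced H (2 ↑ʳ_) (λ {i} {j} → ↑ʳ-injective 2 i j) ΔH))))
  where
  -- σ fixes 0 and sends 1 to suc p, so 0~p is literally an edge 0 – 1 of H.
  σ : Permutation (suc (suc n)) (suc (suc n))
  σ = transpose (suc zero) (suc p)
  H : Graph (suc (suc n))
  H = induced G (σ ⟨$⟩ʳ_)
  ΔH : MaxDegree≤1 (adj H)
  ΔH = maxDegree≤1-resp-≅ᵣ (induced-≅ᵣ G σ) Δ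

decomposition⇔maxDegree≤1 : (G : Graph n) → K₁K₂Decomposition G ⇔ MaxDegree≤1 (adj G)
decomposition⇔maxDegree≤1 G = mk⇔ (decomposition⇒maxDegree≤1 G) (maxDegree≤1⇒decomposition G)

decomposition⇔isomorphic : (G : Graph n) →
  K₁K₂Decomposition G ⇔ (Σ ℕ λ s → Σ ℕ λ t → (2 * t + s ≡ n) × (G ≅ (copies s (K 1) ⊕ copies t (K 2))))
decomposition⇔isomorphic G = mk⇔
  (λ (decomposition s t size (mk≅ᵣ f preserves)) → s , t , size , f , preserves)
  (λ (s , t , size , f , preserves) → decomposition s t size (mk≅ᵣ f preserves))

corollary2p3 : (n : ℕ) (G : Graph n) →
    (noc G ≤ 2 ^ n) ×
    (noc G ≡ 2 ^ n ⇔
      Σ ℕ λ s → Σ ℕ λ t → (2 * t + s ≡ n) × (G ≅ (copies s (K 1) ⊕ copies t (K 2))))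
corollary2p3 n G = noc≤2^n G ,
  ⇔.trans (noc≡2^n⇔allConvex G)
  (⇔.trans (allConvex⇔maxDegree≤1 G)
  (⇔.trans (⇔.sym (decomposition⇔maxDegree≤1 G))
           (decomposition⇔isomorphic G)))
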